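{- Let $G$ be a complete graph with $n$ vertices, let $f_0,f_t$ be token-placements of $G$, and let $\mathcal{C}^*$ be an optimal cycle cover of the destination graph $D(f_0,f_t)$. Then $\mathrm{OPT}(f_0,f_t)\le n-|\mathcal{C}^*|$.
   Context: $C=\{1,\dots,c\}$ is a set of colors; a token-placement of $G=(V,E)$ is a surjective map $V\to C$. A swap along an edge $(u,v)$ exchanges the values at $u$ and $v$; $\mathrm{OPT}(f,f')$ is the minimum number of swaps transforming $f$ into $f'$. The destination graph $D(f_0,f_t)$ is the directed graph on $V$ with an arc $(u,v)$ (self-loops allowed) iff $f_0(u)=f_t(v)$. A (vertex-disjoint) cycle cover is a set of vertex-disjoint directed cycles of $D(f_0,f_t)$ (self-loops count as one-vertex cycles) covering all vertices; it is optimal if the number of cycles in it is maximum among all cycle covers of $D(f_0,f_t)$. -}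

module Defs where

open import Data.Nat using (ℕ; _≤_; _∸_)
open import Data.Fin using (Fin; _≟_)
open import Data.List using (List; []; _∷_; length; concat)
open import Data.List.Base using (allFin)
open import Data.List.Relation.Unary.All using (All)
open import Data.List.Relation.Binary.Permutation.Propositional using (_↭_)
open import Data.Empty using (⊥)
open import Data.Product using (Σ; ∃; _×_; _,_)
open import Relation.Binary.PropositionalEquality using (_≡_; _≢_)
open import Relation.Nullary using (yes; no)

IsTokenPlacement : ∀ {n c} → (Fin n → Fin c) → Set
IsTokenPlacement {n} {c} f = (col : Fin c) → ∃ λ (v : Fin n) → f v ≡ col

swapAt : ∀ {n c} → (Fin n → Fin c) → Fin n → Fin n → (Fin n → Fin c)
swapAt f u v w with w ≟ u
... | yes _ = f v
... | no _ with w ≟ v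
...   | yes _ = f u
...   | no _ = f w

-- Edges of the complete graph K_n: pairs of distinct vertices.
Edge : ℕ → Set
Edge n = Σ (Fin n) λ u → Σ (Fin n) λ v → u ≢ v

applySwaps : ∀ {n c} → List (Edge n) → (Fin n → Fin c) → (Fin n → Fin c)
applySwaps [] f = f
applySwaps ((u , v , _) ∷ s) f = applySwaps s (swapAt f u v)

Transforms : ∀ {n c} → List (Edge n) → (Fin n → Fin c) → (Fin n → Fin c) → Set
Transforms s f f' = ∀ w → applySwaps s f w ≡ f' w

IsOPT : ∀ {n c} → (Fin n → Fin c) → (Fin n → Fin c) → ℕ → Set
IsOPT {n} f f' k =
  (∃ λ (s : List (Edge n)) → length s ≡ k × Transforms s f f')
  × (∀ (s : List (Edge n)) → Transforms s f f' → k ≤ length s)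

-- Destination graph D(f0, ft): arc (u, v) iff f0 u ≡ ft v.
Arc : ∀ {n c} → (Fin n → Fin c) → (Fin n → Fin c) → Fin n → Fin n → Set
Arc f0 ft u v = f0 u ≡ ft v

ClosedWalkFrom : ∀ {n c} → (Fin n → Fin c) → (Fin n → Fin c) →
                 Fin n → Fin n → List (Fin n) → Set
ClosedWalkFrom f0 ft first x [] = Arc f0 ft x first
ClosedWalkFrom f0 ft first x (y ∷ ys) = Arc f0 ft x y × ClosedWalkFrom f0 ft first y ys

-- A directed cycle of D(f0, ft), given by its list of vertices v₁ … v_k
-- (k ≥ 1; a self-loop is the cycle [v]); vertices are pairwise distinct
-- (distinctness is enforced by the cover condition below).
IsCycle : ∀ {n c} → (Fin n → Fin c) → (Fin n → Fin c) → List (Fin n) → Set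
IsCycle f0 ft [] = ⊥
IsCycle f0 ft (x ∷ xs) = ClosedWalkFrom f0 ft x x xs

-- A vertex-disjoint cycle cover: a list of cycles whose vertex lists,
-- concatenated, are a permutation of all vertices (so the cycles are simple,
-- pairwise vertex-disjoint and cover V).
IsCycleCover : ∀ {n c} → (Fin n → Fin c) → (Fin n → Fin c) → List (List (Fin n)) → Set
IsCycleCover {n} f0 ft C = All (IsCycle f0 ft) C × (concat C ↭ allFin n)

IsOptimalCycleCover : ∀ {n c} → (Fin n → Fin c) → (Fin n → Fin c) → List (List (Fin n)) → Set
IsOptimalCycleCover f0 ft C =
  IsCycleCover f0 ft C × (∀ C' → IsCycleCover f0 ft C' → length C' ≤ length C)

-- Proof idea: each cycle v₀ → v₁ → … → v_{k-1} → v₀ of a cycle cover of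
-- D(f₀, fₜ) is realised by the k − 1 star swaps (v₀,v₁), (v₀,v₂), …,
-- (v₀,v_{k-1}) of K_n, which rotate the tokens of the cycle one step along its
-- arcs and touch no other vertex. Concatenating these over the vertex-disjoint
-- cycles transforms f₀ into fₜ with Σ (|c| − 1) = n − |C| swaps, so OPT is at
-- most that for every cycle cover C.
module Submission where

open import Defs
open import Data.Nat using (ℕ; suc; _+_; _≤_; _∸_)
open import Data.Nat.Properties using (m+n∸n≡m; +-suc; +-assoc)
open import Data.Fin using (Fin; _≟_)
open import Data.List using (List; []; _∷_; _++_; length; concat; allFin)
open import Data.List.Properties using (length-++; length-tabulate)
open import Data.List.Relation.Unary.All as All using (All; []; _∷_)
import Data.List.Relation.Unary.All.Properties as All
open import Data.List.Relation.Unary.All.Properties using (All¬⇒¬Any)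
open import Data.List.Relation.Unary.AllPairs using ([]; _∷_)
open import Data.List.Relation.Unary.Any using (here; there)
open import Data.List.Relation.Unary.Unique.Propositional using (Unique)
open import Data.List.Relation.Unary.Unique.Propositional.Properties using (allFin⁺)
open import Data.List.Relation.Binary.Disjoint.Propositional using (Disjoint)
open import Data.List.Relation.Binary.Permutation.Propositional using (↭-sym; ↭⇒↭ₛ)
open import Data.List.Relation.Binary.Permutation.Propositional.Properties using (∈-resp-↭; ↭-length)
open import Data.List.Relation.Binary.Permutation.Setoid.Properties using (Unique-resp-↭)
open import Data.List.Membership.Propositional using (_∈_; _∉_)
open import Data.List.Membership.Propositional.Properties using (∈-++⁺ˡ; ∈-++⁺ʳ; ∈-++⁻; ∈-allFin)
open import Data.Product using (∃; _×_; _,_; proj₁; proj₂)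
open import Data.Sum using (_⊎_; inj₁; inj₂)
open import Data.Empty using (⊥-elim)
open import Function using (id; _∘′_)
open import Relation.Binary.PropositionalEquality
  using (_≡_; _≢_; refl; sym; trans; cong; cong₂; subst; ≢-sym; setoid; module ≡-Reasoning)
open import Relation.Nullary using (yes; no)

_≗_on_ : ∀ {a b} {A : Set a} {B : Set b} → (A → B) → (A → B) → List A → Set _
f ≗ g on xs = ∀ {x} → x ∈ xs → f x ≡ g x

Unique-++⁻ˡ : ∀ {a} {A : Set a} (xs : List A) {ys} → Unique (xs ++ ys) → Unique xs
Unique-++⁻ˡ []       _          = []
Unique-++⁻ˡ (x ∷ xs) (x∉ ∷ uxs) = All.++⁻ˡ xs x∉ ∷ Unique-++⁻ˡ xs uxs

Unique-++⁻ʳ : ∀ {a} {A : Set a} (xs : List A) {ys} → Unique (xs ++ ys) → Unique ys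
Unique-++⁻ʳ []       u         = u
Unique-++⁻ʳ (x ∷ xs) (_ ∷ uxs) = Unique-++⁻ʳ xs uxs

Unique-++⇒Disjoint : ∀ {a} {A : Set a} (xs : List A) {ys} → Unique (xs ++ ys) → Disjoint xs ys
Unique-++⇒Disjoint (x ∷ xs) (x∉ ∷ _)  (here refl , v∈ys) = All.lookup (All.++⁻ʳ xs x∉) v∈ys refl
Unique-++⇒Disjoint (x ∷ xs) (_ ∷ uxs) (there v∈xs , v∈ys) = Unique-++⇒Disjoint xs uxs (v∈xs , v∈ys)

star : ∀ {n} (x : Fin n) (ys : List (Fin n)) → All (x ≢_) ys → List (Edge n)
star x []       []            = []
star x (y ∷ ys) (x≢y ∷ x∉ys) = (x , y , x≢y) ∷ star x ys x∉ys

length-star : ∀ {n} (x : Fin n) ys (x∉ys : All (x ≢_) ys) → length (star x ys x∉ys) ≡ length ys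
length-star x []       []         = refl
length-star x (y ∷ ys) (_ ∷ x∉ys) = cong suc (length-star x ys x∉ys)

cycleSwaps : ∀ {n} (cyc : List (Fin n)) → Unique cyc → List (Edge n)
cycleSwaps []       _          = []
cycleSwaps (x ∷ ys) (x∉ys ∷ _) = star x ys x∉ys

coverSwaps : ∀ {n} (C : List (List (Fin n))) → Unique (concat C) → List (Edge n)
coverSwaps []        _ = []
coverSwaps (cyc ∷ C) u = cycleSwaps cyc (Unique-++⁻ˡ cyc u) ++ coverSwaps C (Unique-++⁻ʳ cyc u)

module _ {n c : ℕ} where

  swapAt-at-left : (g : Fin n → Fin c) (u v : Fin n) → swapAt g u v u ≡ g v
  swapAt-at-left g u v with u ≟ u
  ... | yes _   = refl
  ... | no u≢u = ⊥-elim (u≢u refl)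

  swapAt-at-right : (g : Fin n → Fin c) (u v : Fin n) → swapAt g u v v ≡ g u
  swapAt-at-right g u v with v ≟ u
  ... | yes refl = refl
  ... | no _ with v ≟ v
  ...   | yes _   = refl
  ...   | no v≢v = ⊥-elim (v≢v refl)

  swapAt-elsewhere : (g : Fin n → Fin c) {u v w : Fin n} → w ≢ u → w ≢ v → swapAt g u v w ≡ g w
  swapAt-elsewhere g {u} {v} {w} w≢u w≢v with w ≟ u
  ... | yes w≡u = ⊥-elim (w≢u w≡u)
  ... | no _ with w ≟ v
  ...   | yes w≡v = ⊥-elim (w≢v w≡v)
  ...   | no _    = refl

  applySwaps-++ : (s t : List (Edge n)) (g : Fin n → Fin c) →
                  applySwaps (s ++ t) g ≡ applySwaps t (applySwaps s g)
  applySwaps-++ []                t g = refl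
  applySwaps-++ ((u , v , _) ∷ s) t g = applySwaps-++ s t (swapAt g u v)

  star-elsewhere : (x : Fin n) (ys : List (Fin n)) (x∉ys : All (x ≢_) ys) (g : Fin n → Fin c)
                   {v : Fin n} → v ≢ x → v ∉ ys → applySwaps (star x ys x∉ys) g v ≡ g v
  star-elsewhere x []       []         g v≢x v∉ys = refl
  star-elsewhere x (y ∷ ys) (_ ∷ x∉ys) g v≢x v∉ys =
    trans (star-elsewhere x ys x∉ys (swapAt g x y) v≢x (v∉ys ∘′ there))
          (swapAt-elsewhere g v≢x (v∉ys ∘′ here))

  cycleSwaps-elsewhere : (cyc : List (Fin n)) (u : Unique cyc) (g : Fin n → Fin c) {v : Fin n} →
                         v ∉ cyc → applySwaps (cycleSwaps cyc u) g v ≡ g v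
  cycleSwaps-elsewhere []       _          g v∉ = refl
  cycleSwaps-elsewhere (x ∷ ys) (x∉ys ∷ _) g v∉ =
    star-elsewhere x ys x∉ys g (v∉ ∘′ here) (v∉ ∘′ there)

  coverSwaps-elsewhere : (C : List (List (Fin n))) (u : Unique (concat C)) (g : Fin n → Fin c) {v : Fin n} →
                         v ∉ concat C → applySwaps (coverSwaps C u) g v ≡ g v
  coverSwaps-elsewhere []        _ g v∉ = refl
  coverSwaps-elsewhere (cyc ∷ C) u g {v} v∉ = begin
    applySwaps (cycleSwaps cyc uc ++ coverSwaps C uC) g v
      ≡⟨ cong (λ h → h v) (applySwaps-++ (cycleSwaps cyc uc) (coverSwaps C uC) g) ⟩
    applySwaps (coverSwaps C uC) (applySwaps (cycleSwaps cyc uc) g) v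
      ≡⟨ coverSwaps-elsewhere C uC _ (v∉ ∘′ ∈-++⁺ʳ cyc) ⟩
    applySwaps (cycleSwaps cyc uc) g v
      ≡⟨ cycleSwaps-elsewhere cyc uc g (v∉ ∘′ ∈-++⁺ˡ) ⟩
    g v ∎
    where
    open ≡-Reasoning
    uc : Unique cyc
    uc = Unique-++⁻ˡ cyc u
    uC : Unique (concat C)
    uC = Unique-++⁻ʳ cyc u

module _ {n c : ℕ} (f₀ fₜ : Fin n → Fin c) where

  -- Invariant of the star swaps: the token at the centre x is the one that
  -- f₀ placed on p, the vertex of the walk immediately before ys.
  star-follows-walk : (first x p : Fin n) (ys : List (Fin n)) (x∉ys : All (x ≢_) ys) →
    Unique ys → ClosedWalkFrom f₀ fₜ first p ys →
    (g : Fin n → Fin c) → g x ≡ f₀ p → g ≗ f₀ on ys →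
    applySwaps (star x ys x∉ys) g x ≡ fₜ first × applySwaps (star x ys x∉ys) g ≗ fₜ on ys
  star-follows-walk first x p [] [] [] last→first g gx≡f₀p _ = trans gx≡f₀p last→first , λ ()
  star-follows-walk first x p (y ∷ ys) (x≢y ∷ x∉ys) (y∉ys ∷ uys) (p→y , walk) g gx≡f₀p g≗f₀ =
    proj₁ rest , λ { (here refl) → hy ; (there v∈ys) → proj₂ rest v∈ys }
    where
    g′ : Fin n → Fin c
    g′ = swapAt g x y

    g′≗f₀ : g′ ≗ f₀ on ys
    g′≗f₀ v∈ys = trans (swapAt-elsewhere g (λ v≡x → All.lookup x∉ys v∈ys (sym v≡x))
                                            (λ v≡y → All.lookup y∉ys v∈ys (sym v≡y)))
                       (g≗f₀ (there v∈ys))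

    rest : applySwaps (star x ys x∉ys) g′ x ≡ fₜ first × applySwaps (star x ys x∉ys) g′ ≗ fₜ on ys
    rest = star-follows-walk first x y ys x∉ys uys walk g′
             (trans (swapAt-at-left g x y) (g≗f₀ (here refl))) g′≗f₀

    hy : applySwaps (star x ys x∉ys) g′ y ≡ fₜ y
    hy = begin
      applySwaps (star x ys x∉ys) g′ y  ≡⟨ star-elsewhere x ys x∉ys g′ (≢-sym x≢y) (All¬⇒¬Any y∉ys) ⟩
      g′ y                              ≡⟨ swapAt-at-right g x y ⟩
      g x                               ≡⟨ gx≡f₀p ⟩
      f₀ p                              ≡⟨ p→y ⟩
      fₜ y                              ∎
      where open ≡-Reasoning

  cycleSwaps-realises : (cyc : List (Fin n)) (u : Unique cyc) → IsCycle f₀ fₜ cyc →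
                        (g : Fin n → Fin c) → g ≗ f₀ on cyc → applySwaps (cycleSwaps cyc u) g ≗ fₜ on cyc
  cycleSwaps-realises (x ∷ ys) (x∉ys ∷ uys) walk g g≗f₀ =
    λ { (here refl) → proj₁ rotated ; (there v∈ys) → proj₂ rotated v∈ys }
    where
    rotated : applySwaps (star x ys x∉ys) g x ≡ fₜ x × applySwaps (star x ys x∉ys) g ≗ fₜ on ys
    rotated = star-follows-walk x x x ys x∉ys uys walk g (g≗f₀ (here refl)) (g≗f₀ ∘′ there)

  coverSwaps-realises : (C : List (List (Fin n))) (u : Unique (concat C)) → All (IsCycle f₀ fₜ) C →
                        (g : Fin n → Fin c) → g ≗ f₀ on concat C → applySwaps (coverSwaps C u) g ≗ fₜ on concat C
  coverSwaps-realises (cyc ∷ C) u (walk ∷ walks) g g≗f₀ {v} v∈ =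
    trans (cong (λ h → h v) (applySwaps-++ (cycleSwaps cyc uc) (coverSwaps C uC) g)) (realised (∈-++⁻ cyc v∈))
    where
    uc : Unique cyc
    uc = Unique-++⁻ˡ cyc u
    uC : Unique (concat C)
    uC = Unique-++⁻ʳ cyc u
    g₁ : Fin n → Fin c
    g₁ = applySwaps (cycleSwaps cyc uc) g

    g₁≗f₀ : g₁ ≗ f₀ on concat C
    g₁≗f₀ {y} y∈C = trans (cycleSwaps-elsewhere cyc uc g (λ y∈cyc → Unique-++⇒Disjoint cyc u (y∈cyc , y∈C)))
                          (g≗f₀ (∈-++⁺ʳ cyc y∈C))

    realised : v ∈ cyc ⊎ v ∈ concat C → applySwaps (coverSwaps C uC) g₁ v ≡ fₜ v
    realised (inj₁ v∈cyc) =
      trans (coverSwaps-elsewhere C uC g₁ (λ v∈C → Unique-++⇒Disjoint cyc u (v∈cyc , v∈C)))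
            (cycleSwaps-realises cyc uc walk g (g≗f₀ ∘′ ∈-++⁺ˡ) v∈cyc)
    realised (inj₂ v∈C) = coverSwaps-realises C uC walks g₁ g₁≗f₀ v∈C

  length-cycleSwaps : (cyc : List (Fin n)) (u : Unique cyc) → IsCycle f₀ fₜ cyc →
                      suc (length (cycleSwaps cyc u)) ≡ length cyc
  length-cycleSwaps (x ∷ ys) (x∉ys ∷ _) _ = cong suc (length-star x ys x∉ys)

  length-coverSwaps : (C : List (List (Fin n))) (u : Unique (concat C)) → All (IsCycle f₀ fₜ) C →
                      length (coverSwaps C u) + length C ≡ length (concat C)
  length-coverSwaps []        _ []             = refl
  length-coverSwaps (cyc ∷ C) u (walk ∷ walks) = begin
    length (cycleSwaps cyc uc ++ coverSwaps C uC) + suc (length C)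
      ≡⟨ cong (_+ suc (length C)) (length-++ (cycleSwaps cyc uc)) ⟩
    (length (cycleSwaps cyc uc) + length (coverSwaps C uC)) + suc (length C)
      ≡⟨ +-suc _ (length C) ⟩
    suc ((length (cycleSwaps cyc uc) + length (coverSwaps C uC)) + length C)
      ≡⟨ cong suc (+-assoc (length (cycleSwaps cyc uc)) _ _) ⟩
    suc (length (cycleSwaps cyc uc)) + (length (coverSwaps C uC) + length C)
      ≡⟨ cong₂ _+_ (length-cycleSwaps cyc uc walk) (length-coverSwaps C uC walks) ⟩
    length cyc + length (concat C)
      ≡⟨ sym (length-++ cyc) ⟩
    length (cyc ++ concat C) ∎
    where
    open ≡-Reasoning
    uc : Unique cyc
    uc = Unique-++⁻ˡ cyc u
    uC : Unique (concat C)
    uC = Unique-++⁻ʳ cyc u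

  cycleCover⇒swaps : (C : List (List (Fin n))) → IsCycleCover f₀ fₜ C →
                     ∃ λ s → Transforms s f₀ fₜ × length s ≡ n ∸ length C
  cycleCover⇒swaps C (walks , C↭V) = coverSwaps C u , transforms , length≡
    where
    u : Unique (concat C)
    u = Unique-resp-↭ (setoid (Fin n)) (↭⇒↭ₛ (↭-sym C↭V)) (allFin⁺ n)

    transforms : Transforms (coverSwaps C u) f₀ fₜ
    transforms v = coverSwaps-realises C u walks f₀ (λ _ → refl) (∈-resp-↭ (↭-sym C↭V) (∈-allFin v))

    length≡ : length (coverSwaps C u) ≡ n ∸ length C
    length≡ = begin
      length (coverSwaps C u)                       ≡⟨ m+n∸n≡m _ (length C) ⟨
      length (coverSwaps C u) + length C ∸ length C ≡⟨ cong (_∸ length C) (length-coverSwaps C u walks) ⟩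
      length (concat C) ∸ length C                  ≡⟨ cong (_∸ length C) (↭-length C↭V) ⟩
      length (allFin n) ∸ length C                  ≡⟨ cong (_∸ length C) (length-tabulate id) ⟩
      n ∸ length C                                  ∎
      where open ≡-Reasoning

corollary2 : (n c : ℕ) (f₀ fₜ : Fin n → Fin c) →
    IsTokenPlacement f₀ → IsTokenPlacement fₜ →
    (C* : List (List (Fin n))) → IsOptimalCycleCover f₀ fₜ C* →
    (k : ℕ) → IsOPT f₀ fₜ k → k ≤ n ∸ length C*
corollary2 n c f₀ fₜ _ _ C* (cover , _) k (_ , minimal) =
  let s , transforms , length≡ = cycleCover⇒swaps f₀ fₜ C* cover
  in  subst (k ≤_) length≡ (minimal s transforms)
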